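{- Let $M_{d,k}=\{g\in G_{d,k}:\theta_i(g)=0\ \text{for all } i\in[\![d]\!]\}$. Then $M_{d,k}$ is a normal subgroup of $G_{d,k}$ of index $k^{d+1}$ with $G_{d,k}/M_{d,k}\cong(\mathbb Z/k\mathbb Z)^{d+1}$. Moreover, $\widetilde{\mathfrak X}_{d,k}(M_{d,k})$ is isomorphic to the complete $(d+1)$-partite $d$-complex all of whose parts have size $k$.
   Context: $[\![d]\!]=\{0,\dots,d\}$, $G_{d,k}=\langle\alpha_0,\dots,\alpha_d\mid\alpha_i^k=e\rangle$. For $g$ represented by a word $\alpha_{i_m}^{l_m}\cdots\alpha_{i_1}^{l_1}$, $\theta_i(g)=\sum_{j:\,i_j=i}l_j\bmod k$ (independent of the word; a homomorphism to $\mathbb Z/k\mathbb Z$). For $J\subseteq[\![d]\!]$: $K_J=\langle\alpha_j:j\in J\rangle$, $\widehat J=[\![d]\!]\setminus J$, $\widehat i=\widehat{\{i\}}$. For $H\le G_{d,k}$, right cosets $K_{\widehat J}g,K_{\widehat{J'}}g'$ are equivalent if $\{K_{\widehat J}gh:h\in H\}=\{K_{\widehat{J'}}g'h:h\in H\}$; $[K_{\widehat J}g]_H$ is the class, $\mathcal M(H)$ the set of classes, $\Phi([K_{\widehat J}g]_H)=\{[K_{\widehat i}g]_H:i\in J\}$, and $\mathfrak X_{d,k}(H)=\Phi(\mathcal M(H))$. $\widetilde{\mathfrak X}_{d,k}(H)$ is the multicomplex over $\mathfrak X_{d,k}(H)$ whose multicells over $\sigma$ are the elements of $\Phi^{ -1}(\sigma)$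 (multiplicity $|\Phi^{ -1}(\sigma)|$), with multiboundary of $[K_{\widehat J}g]_H$ equal to $\{[K_{\widehat{J\setminus\{l\}}}g]_H:l\in J\}$; a simplicial complex is regarded as a multicomplex with all multiplicities $1$. The complete $(d+1)$-partite $d$-complex with parts of size $k$ has vertex set $V_0\sqcup\cdots\sqcup V_d$, $|V_i|=k$, and as cells all subsets meeting each $V_i$ in at most one vertex. -}

module Defs where

open import Data.Nat using (ℕ; zero; suc; _+_; _∸_; NonZero)
open import Data.Nat.DivMod using (_mod_)
open import Data.Fin using (Fin; toℕ; _≟_)
open import Data.Fin.Subset using (Subset; _∈_; ∁; _─_; ⁅_⁆; ∣_∣)
open import Data.Bool using (Bool; true; false; if_then_else_; _∧_; not)
open import Data.List using (List; []; _∷_; _++_; reverse; map; allFin)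
open import Data.Nat.ListAction using (sum)
open import Data.List.Relation.Unary.All using (All)
open import Data.Product using (Σ; ∃; _×_; _,_; proj₁; proj₂)
open import Relation.Nullary.Decidable using (⌊_⌋)
open import Relation.Binary.PropositionalEquality using (_≡_)
open import Relation.Binary.Construct.Closure.Equivalence using (EqClosure)
open import Function.Bundles using (_⇔_)

-- The free product G_{d,k} = ⟨α_0,…,α_d ∣ α_i^k = e⟩, its subgroup M_{d,k},
-- the multicomplex X̃_{d,k}(H), and the complete (d+1)-partite d-complex.
module G (d k : ℕ) {{nz : NonZero k}} where

  -- a letter (i , a) stands for α_i^a with a ∈ ℤ/kℤ
  Letter : Set
  Letter = Fin (suc d) × Fin k

  -- a word (i₁,l₁) ∷ … ∷ (i_m,l_m) ∷ [] stands for the product, read left to right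
  Word : Set
  Word = List Letter

  _+ₖ_ : Fin k → Fin k → Fin k
  a +ₖ b = (toℕ a + toℕ b) mod k

  -ₖ_ : Fin k → Fin k
  -ₖ a = (k ∸ toℕ a) mod k

  data Step : Word → Word → Set where
    merge : ∀ u v i a b → Step (u ++ (i , a) ∷ (i , b) ∷ v) (u ++ (i , a +ₖ b) ∷ v)
    drop0 : ∀ u v i a → toℕ a ≡ 0 → Step (u ++ (i , a) ∷ v) (u ++ v)

  _≈_ : Word → Word → Set
  _≈_ = EqClosure Step

  e : Word
  e = []

  _·_ : Word → Word → Word
  g · h = g ++ h

  inv : Word → Word
  inv g = reverse (map (λ l → proj₁ l , -ₖ proj₂ l) g)

  expSum : Fin (suc d) → Word → ℕ
  expSum i [] = 0
  expSum i ((j , a) ∷ w) = if ⌊ i ≟ j ⌋ then toℕ a + expSum i w else expSum i w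

  θ : Fin (suc d) → Word → Fin k
  θ i w = expSum i w mod k

  M : Word → Set
  M g = ∀ i → toℕ (θ i g) ≡ 0

  Zk^ : Set
  Zk^ = Fin (suc d) → Fin k

  _⊕_ : Zk^ → Zk^ → Zk^
  (x ⊕ y) i = x i +ₖ y i

  _≋_ : Zk^ → Zk^ → Set
  x ≋ y = ∀ i → x i ≡ y i

  InK : Subset (suc d) → Word → Set
  InK J x = Σ Word λ w → All (λ l → proj₁ l ∈ J) w × (w ≈ x)

  InCoset : Subset (suc d) → Word → Word → Set
  InCoset A g x = Σ Word λ y → InK A y × (x ≈ (y · g))

  SameCoset : Subset (suc d) → Word → Subset (suc d) → Word → Set
  SameCoset A g B g' = ∀ x → InCoset A g x ⇔ InCoset B g' x

  -- representatives (J , g) of the cosets K_{Ĵ} g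
  Multicell : Set
  Multicell = Subset (suc d) × Word

  Equiv : (Word → Set) → Multicell → Multicell → Set
  Equiv H (J , g) (J' , g') =
    (∀ h → H h → Σ Word λ h' → H h' × SameCoset (∁ J) (g · h) (∁ J') (g' · h'))
    × (∀ h' → H h' → Σ Word λ h → H h × SameCoset (∁ J) (g · h) (∁ J') (g' · h'))

  InBoundary : (Word → Set) → Multicell → Multicell → Set
  InBoundary H c' (J , g) = Σ (Fin (suc d)) λ l → l ∈ J × Equiv H c' (J ─ ⁅ l ⁆ , g)

  rank : Multicell → ℕ
  rank (J , _) = ∣ J ∣

  -- Complete (d+1)-partite d-complex with parts V_i = {i} × Fin k.
  -- A cell is a subset σ of V_0 ⊔ … ⊔ V_d (σ i a ≡ true iff (i , a) ∈ σ)
  -- meeting each V_i in at most one vertex.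
  Cell : Set
  Cell = Σ (Fin (suc d) → Fin k → Bool)
           λ σ → ∀ i a b → σ i a ≡ true → σ i b ≡ true → a ≡ b

  _≈C_ : Cell → Cell → Set
  σ ≈C τ = ∀ i a → proj₁ σ i a ≡ proj₁ τ i a

  size : Cell → ℕ
  size σ = sum (map (λ i → sum (map (λ a → if proj₁ σ i a then 1 else 0) (allFin k)))
                    (allFin (suc d)))

  Facet : Cell → Cell → Set
  Facet τ σ = Σ (Fin (suc d)) λ i → Σ (Fin k) λ a →
    (proj₁ σ i a ≡ true) ×
    (∀ j b → proj₁ τ j b ≡ (proj₁ σ j b ∧ not (⌊ i ≟ j ⌋ ∧ ⌊ a ≟ b ⌋)))

-- θ = (θ_0, …, θ_d) is additive and invariant under the defining relations, hence a homomorphism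
-- G_{d,k} → (ℤ/kℤ)^{d+1}; it is onto (α_0^{t_0} ⋯ α_d^{t_d} ↦ t) and M_{d,k} is its kernel. This gives
-- normality and the quotient, and the index through Fin (k^{d+1}) ≅ (ℤ/kℤ)^{d+1}.
-- The multicell [K_Ĵ g] is sent to the cell {(i , θ_i g) : i ∈ J}. Words in K_Ĵ only involve generators
-- outside J, so θ_i is constant on K_Ĵ g for i ∈ J; for i ∈ Ĵ it is not, as g and α_i g lie in the coset
-- and 1 ≢ 0 in ℤ/kℤ (k ≥ 2). So the coset determines the cell. Conversely, when the cells of (J , g) and
-- (J , g') agree, a product x of powers of the generators outside J has θ(x g) = θ(g'), and for h ∈ M
-- the element h' = g'⁻¹ x g h lies in M with K_Ĵ g h = K_Ĵ x g h = K_Ĵ g' h'.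

module Submission where

open import Defs
open import Data.Nat using (ℕ; suc; _^_; _≤_; NonZero)
open import Data.Fin using (Fin)
open import Data.Product using (Σ; _×_)
open import Relation.Binary.PropositionalEquality using (_≡_)
open import Function.Bundles using (_⇔_)

open import Level using (0ℓ)
open import Algebra.Bundles using (AbelianGroup)
open import Algebra.Consequences.Propositional using (comm∧idˡ⇒id; comm∧invˡ⇒inv)
open import Algebra.Definitions using (Associative; Commutative; LeftIdentity; LeftInverse)
open import Data.Bool using (Bool; true; false; _∧_; not; if_then_else_)
open import Data.Bool.Properties as Bool using (¬-not; ∧-zeroʳ; ∧-identityʳ)
open import Data.Fin using (zero; suc; toℕ; _≟_; combine; funToFin; finToFun)
open import Data.Fin.Properties using (toℕ-fromℕ<; toℕ-injective; toℕ<n; any?; funToFin-finToFin; finToFun-funToFin)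
open import Data.Fin.Subset using (Subset; _∈_; _∉_; ∁; _─_; ⁅_⁆; ∣_∣; ⊥; ⊤)
open import Data.Fin.Subset.Properties using (_∈?_; ∈⊤; ∣⊥∣≡0; ∣⁅x⁆∣≡1; ⊆-antisym; x∈∁p⇒x∉p; x∉∁p⇒x∈p)
open import Data.List using (List; []; _∷_; _++_; map; filter; allFin)
open import Data.List.Properties using (unfold-reverse; ++-assoc; ++-identityʳ; map-cong; map-tabulate)
import Data.List.Membership.Propositional as List
open import Data.List.Membership.Propositional.Properties using (∈-filter⁺; ∈-filter⁻; ∈-allFin)
open import Data.List.Relation.Unary.All as All using (All; []; _∷_)
open import Data.List.Relation.Unary.All.Properties using (++⁺; map⁺; all-filter; All¬⇒¬Any)
open import Data.List.Relation.Unary.Any using (here; there)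
open import Data.List.Relation.Unary.Unique.Propositional using (Unique)
open import Data.List.Relation.Unary.Unique.Propositional.Properties using (allFin⁺; filter⁺)
open import Data.List.Relation.Unary.AllPairs using (_∷_)
open import Data.Nat using (zero; _+_; _∸_; _%_; >-nonZero⁻¹)
open import Data.Nat.DivMod using (_mod_; %-distribˡ-+; m%n<n; m<n⇒m%n≡m; n%n≡0)
open import Data.Nat.ListAction using (sum)
open import Data.Nat.Properties using (+-assoc; +-comm; m∸n+n≡m; <⇒≤)
open import Data.Vec using (Vec; lookup; tabulate; []; _∷_)
open import Data.Vec.Properties using (lookup-replicate; tabulate∘lookup; tabulate-cong; lookup∘tabulate; []=⇒lookup; lookup⇒[]=)
open import Data.Product using (_,_; proj₁; proj₂)
open import Function using (_∘_)
open import Function.Bundles using (mk⇔; Equivalence)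
open import Relation.Binary.PropositionalEquality using (refl; sym; trans; cong; cong₂; subst; subst₂; _≢_; _≗_; isEquivalence; module ≡-Reasoning)
open import Relation.Binary.Construct.Closure.Equivalence using (gmap; gfold; return; setoid)
open import Relation.Binary.Bundles using (Setoid)
import Relation.Binary.Reasoning.Setoid as ≈-Reasoning
open import Relation.Nullary using (¬_; yes; no; contradiction)
open import Relation.Nullary.Decidable using (⌊_⌋; ⌊⌋-map′)

open Equivalence using (to; from)

≟-sound : ∀ {n} {x y : Fin n} → ⌊ x ≟ y ⌋ ≡ true → x ≡ y
≟-sound {x = x} {y} e with x ≟ y
... | yes x≡y = x≡y

≟-refl : ∀ {n} (x : Fin n) → ⌊ x ≟ x ⌋ ≡ true
≟-refl x with x ≟ x
... | yes _   = refl
... | no x≢x = contradiction refl x≢x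

≗-lookup⇒≡ : ∀ {A : Set} {n} {u v : Vec A n} → lookup u ≗ lookup v → u ≡ v
≗-lookup⇒≡ {u = u} {v} e = trans (sym (tabulate∘lookup u)) (trans (tabulate-cong e) (tabulate∘lookup v))

lookup-⁅⁆ : ∀ {n} (i j : Fin n) → lookup ⁅ i ⁆ j ≡ ⌊ i ≟ j ⌋
lookup-⁅⁆ zero    zero    = refl
lookup-⁅⁆ zero    (suc j) = lookup-replicate j false
lookup-⁅⁆ (suc i) zero    = refl
lookup-⁅⁆ (suc i) (suc j) = trans (lookup-⁅⁆ i j) (sym (⌊⌋-map′ _ _ (i ≟ j)))

lookup-─ : ∀ {n} (p q : Subset n) j → lookup (p ─ q) j ≡ lookup p j ∧ not (lookup q j)
lookup-─ (x ∷ p) (true  ∷ q) zero    = sym (∧-zeroʳ x)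
lookup-─ (x ∷ p) (false ∷ q) zero    = sym (∧-identityʳ x)
lookup-─ (x ∷ p) (y     ∷ q) (suc j) = lookup-─ p q j

funToFin-cong : ∀ {m n} {f g : Fin m → Fin n} → f ≗ g → funToFin f ≡ funToFin g
funToFin-cong {zero}  e = refl
funToFin-cong {suc m} e = cong₂ combine (e zero) (funToFin-cong (e ∘ suc))

count : ∀ {n} → (Fin n → Bool) → ℕ
count {n} s = sum (map (λ a → if s a then 1 else 0) (allFin n))

count-cong : ∀ {n} {s s' : Fin n → Bool} → s ≗ s' → count s ≡ count s'
count-cong e = cong sum (map-cong (λ a → cong (λ b → if b then 1 else 0) (e a)) (allFin _))

count-suc : ∀ {n} (s : Fin (suc n) → Bool) → count s ≡ (if s zero then 1 else 0) + count (s ∘ suc)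
count-suc {n} s = cong (χ zero +_)
  (cong sum (trans (map-tabulate (Data.Fin.suc {n}) χ) (sym (map-tabulate (λ a → a) (χ ∘ suc)))))
  where
  χ : Fin (suc n) → ℕ
  χ a = if s a then 1 else 0

∣p∣≡count : ∀ {n} (p : Subset n) → ∣ p ∣ ≡ count (lookup p)
∣p∣≡count []          = refl
∣p∣≡count (true  ∷ p) = trans (cong suc (∣p∣≡count p)) (sym (count-suc (lookup (true ∷ p))))
∣p∣≡count (false ∷ p) = trans (∣p∣≡count p) (sym (count-suc (lookup (false ∷ p))))

indicator : ∀ {n} → Bool → Fin n → Fin n → Bool
indicator b x a = b ∧ ⌊ x ≟ a ⌋

indicator-true : ∀ {n} b (x a : Fin n) → indicator b x a ≡ true → b ≡ true × x ≡ a
indicator-true true x a x≟a = refl , ≟-sound x≟a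

indicator-functional : ∀ {n} b (x a a' : Fin n) → indicator b x a ≡ true → indicator b x a' ≡ true → a ≡ a'
indicator-functional b x a a' p q = trans (sym (proj₂ (indicator-true b x a p))) (proj₂ (indicator-true b x a' q))

indicator-≗⇔ : ∀ {n} b b' (x x' : Fin n) → (indicator b x ≗ indicator b' x') ⇔ (b ≡ b' × (b ≡ true → x ≡ x'))
indicator-≗⇔ {n} b b' x x' = mk⇔ (⇒ b b') (⇐ b)
  where
  ⇒ : ∀ b b' → indicator b x ≗ indicator b' x' → b ≡ b' × (b ≡ true → x ≡ x')
  ⇒ true  true  e = refl , λ _ → sym (≟-sound (trans (sym (e x)) (≟-refl x)))
  ⇒ true  false e = contradiction (trans (sym (≟-refl x)) (e x)) λ ()
  ⇒ false true  e = contradiction (trans (e x') (≟-refl x')) λ ()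
  ⇒ false false e = refl , λ ()
  ⇐ : ∀ b → b ≡ b' × (b ≡ true → x ≡ x') → indicator b x ≗ indicator b' x'
  ⇐ true  (refl , x≡x') a = cong (λ y → ⌊ y ≟ a ⌋) (x≡x' refl)
  ⇐ false (refl , _)    a = refl

indicator-complete : ∀ {n} (s : Fin n → Bool) → (∀ a a' → s a ≡ true → s a' ≡ true → a ≡ a') →
                     Fin n → Σ Bool λ b → Σ (Fin n) λ x → indicator b x ≗ s
indicator-complete s functional default with any? (λ a → s a Bool.≟ true)
... | yes (x , sx≡true) = true , x , row
  where
  row : ∀ a → ⌊ x ≟ a ⌋ ≡ s a
  row a with x ≟ a
  ... | yes refl = sym sx≡true
  ... | no x≢a   = sym (¬-not (λ sa → x≢a (functional x a sx≡true sa)))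
... | no empty = false , default , λ a → sym (¬-not (λ sa → empty (a , sa)))

count-indicator : ∀ {n} b (x : Fin n) → count (indicator b x) ≡ (if b then 1 else 0)
count-indicator true  x = begin
  count (λ a → ⌊ x ≟ a ⌋) ≡⟨ count-cong (λ a → sym (lookup-⁅⁆ x a)) ⟩
  count (lookup ⁅ x ⁆)    ≡⟨ sym (∣p∣≡count ⁅ x ⁆) ⟩
  ∣ ⁅ x ⁆ ∣               ≡⟨ ∣⁅x⁆∣≡1 x ⟩
  1                       ∎
  where open ≡-Reasoning
count-indicator {n} false x = begin
  count {n} (λ _ → false) ≡⟨ count-cong {n} (λ a → sym (lookup-replicate a false)) ⟩
  count (lookup (⊥ {n}))  ≡⟨ sym (∣p∣≡count (⊥ {n})) ⟩
  ∣ ⊥ {n} ∣               ≡⟨ ∣⊥∣≡0 n ⟩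
  0                       ∎
  where open ≡-Reasoning

∧-not-∧-distrib : ∀ b c y → (b ∧ not c) ∧ y ≡ (b ∧ y) ∧ not (c ∧ y)
∧-not-∧-distrib false c     y     = refl
∧-not-∧-distrib true  false y     = sym (∧-identityʳ y)
∧-not-∧-distrib true  true  false = refl
∧-not-∧-distrib true  true  true  = refl

module _ (d k : ℕ) {{_ : NonZero k}} where
  open G d k

  -- ℤ/kℤ

  0ₖ : Fin k
  0ₖ = 0 mod k

  toℕ-mod : ∀ n → toℕ (n mod k) ≡ n % k
  toℕ-mod n = toℕ-fromℕ< (m%n<n n k)

  toℕ-0ₖ : toℕ 0ₖ ≡ 0
  toℕ-0ₖ = trans (toℕ-mod 0) (m<n⇒m%n≡m (>-nonZero⁻¹ k))

  toℕ≡0⇒≡0ₖ : ∀ {a} → toℕ a ≡ 0 → a ≡ 0ₖ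
  toℕ≡0⇒≡0ₖ p = toℕ-injective (trans p (sym toℕ-0ₖ))

  mod-toℕ : ∀ a → toℕ a mod k ≡ a
  mod-toℕ a = toℕ-injective (trans (toℕ-mod (toℕ a)) (m<n⇒m%n≡m (toℕ<n a)))

  mod-+ : ∀ m n → (m + n) mod k ≡ (m mod k) +ₖ (n mod k)
  mod-+ m n = toℕ-injective (begin
    toℕ ((m + n) mod k)                      ≡⟨ toℕ-mod (m + n) ⟩
    (m + n) % k                              ≡⟨ %-distribˡ-+ m n k ⟩
    (m % k + n % k) % k                      ≡⟨ cong₂ (λ x y → (x + y) % k) (toℕ-mod m) (toℕ-mod n) ⟨
    (toℕ (m mod k) + toℕ (n mod k)) % k      ≡⟨ toℕ-mod _ ⟨
    toℕ ((m mod k) +ₖ (n mod k))             ∎)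
    where open ≡-Reasoning

  +ₖ-assoc : Associative _≡_ _+ₖ_
  +ₖ-assoc a b c = begin
    (a +ₖ b) +ₖ c                            ≡⟨ cong ((a +ₖ b) +ₖ_) (mod-toℕ c) ⟨
    ((toℕ a + toℕ b) mod k) +ₖ (toℕ c mod k) ≡⟨ mod-+ (toℕ a + toℕ b) (toℕ c) ⟨
    (toℕ a + toℕ b + toℕ c) mod k            ≡⟨ cong (_mod k) (+-assoc (toℕ a) (toℕ b) (toℕ c)) ⟩
    (toℕ a + (toℕ b + toℕ c)) mod k          ≡⟨ mod-+ (toℕ a) (toℕ b + toℕ c) ⟩
    (toℕ a mod k) +ₖ (b +ₖ c)                ≡⟨ cong (_+ₖ (b +ₖ c)) (mod-toℕ a) ⟩
    a +ₖ (b +ₖ c)                            ∎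
    where open ≡-Reasoning

  +ₖ-comm : Commutative _≡_ _+ₖ_
  +ₖ-comm a b = cong (_mod k) (+-comm (toℕ a) (toℕ b))

  +ₖ-identityˡ : LeftIdentity _≡_ 0ₖ _+ₖ_
  +ₖ-identityˡ a = begin
    0ₖ +ₖ a                ≡⟨ cong (0ₖ +ₖ_) (mod-toℕ a) ⟨
    (0 mod k) +ₖ (toℕ a mod k) ≡⟨ mod-+ 0 (toℕ a) ⟨
    toℕ a mod k            ≡⟨ mod-toℕ a ⟩
    a                      ∎
    where open ≡-Reasoning

  -ₖ-inverseˡ : LeftInverse _≡_ 0ₖ -ₖ_ _+ₖ_
  -ₖ-inverseˡ a = begin
    (-ₖ a) +ₖ a                          ≡⟨ cong ((-ₖ a) +ₖ_) (mod-toℕ a) ⟨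
    ((k ∸ toℕ a) mod k) +ₖ (toℕ a mod k) ≡⟨ mod-+ (k ∸ toℕ a) (toℕ a) ⟨
    (k ∸ toℕ a + toℕ a) mod k            ≡⟨ cong (_mod k) (m∸n+n≡m (<⇒≤ (toℕ<n a))) ⟩
    k mod k                              ≡⟨ toℕ≡0⇒≡0ₖ (trans (toℕ-mod k) (n%n≡0 k)) ⟩
    0ₖ                                   ∎
    where open ≡-Reasoning

  ℤ/kℤ : AbelianGroup 0ℓ 0ℓ
  ℤ/kℤ = record
    { Carrier        = Fin k
    ; _≈_            = _≡_
    ; _∙_            = _+ₖ_
    ; ε              = 0ₖ
    ; _⁻¹            = -ₖ_
    ; isAbelianGroup = record
      { isGroup = record
        { isMonoid = record
          { isSemigroup = record
            { isMagma = record { isEquivalence = isEquivalence ; ∙-cong = cong₂ _+ₖ_ }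
            ; assoc   = +ₖ-assoc
            }
          ; identity = comm∧idˡ⇒id +ₖ-comm +ₖ-identityˡ
          }
        ; inverse = comm∧invˡ⇒inv +ₖ-comm -ₖ-inverseˡ
        ; ⁻¹-cong = cong -ₖ_
        }
      ; comm = +ₖ-comm
      }
    }

  open AbelianGroup ℤ/kℤ using (identityʳ; inverseʳ)
  open import Algebra.Properties.AbelianGroup ℤ/kℤ
    using (ε⁻¹≈ε; ⁻¹-∙-comm; x∙y⁻¹≈ε⇒x≈y; x≈y⇒x∙y⁻¹≈ε; ∙-cancelʳ; //-rightDividesˡ)

  -- Exponent sums

  θ₁ : Fin (suc d) → Letter → Fin k
  θ₁ i (j , a) = if ⌊ i ≟ j ⌋ then a else 0ₖ

  θ₁-≡ : ∀ i a → θ₁ i (i , a) ≡ a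
  θ₁-≡ i a rewrite ≟-refl i = refl

  θ₁-≢ : ∀ {i j} a → i ≢ j → θ₁ i (j , a) ≡ 0ₖ
  θ₁-≢ {i} {j} a i≢j with i ≟ j
  ... | yes i≡j = contradiction i≡j i≢j
  ... | no _    = refl

  θ-∷ : ∀ i l w → θ i (l ∷ w) ≡ θ₁ i l +ₖ θ i w
  θ-∷ i (j , a) w with ⌊ i ≟ j ⌋
  ... | true  = trans (mod-+ (toℕ a) (expSum i w)) (cong (_+ₖ θ i w) (mod-toℕ a))
  ... | false = sym (+ₖ-identityˡ (θ i w))

  θ-++ : ∀ i u v → θ i (u ++ v) ≡ θ i u +ₖ θ i v
  θ-++ i []      v = sym (+ₖ-identityˡ (θ i v))
  θ-++ i (l ∷ u) v = begin
    θ i (l ∷ u ++ v)                 ≡⟨ θ-∷ i l (u ++ v) ⟩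
    θ₁ i l +ₖ θ i (u ++ v)           ≡⟨ cong (θ₁ i l +ₖ_) (θ-++ i u v) ⟩
    θ₁ i l +ₖ (θ i u +ₖ θ i v)       ≡⟨ +ₖ-assoc (θ₁ i l) (θ i u) (θ i v) ⟨
    (θ₁ i l +ₖ θ i u) +ₖ θ i v       ≡⟨ cong (_+ₖ θ i v) (θ-∷ i l u) ⟨
    θ i (l ∷ u) +ₖ θ i v             ∎
    where open ≡-Reasoning

  θ-singleton : ∀ i l → θ i (l ∷ []) ≡ θ₁ i l
  θ-singleton i l = trans (θ-∷ i l []) (identityʳ (θ₁ i l))

  θ-congˡ : ∀ i u {v w} → θ i v ≡ θ i w → θ i (u ++ v) ≡ θ i (u ++ w)
  θ-congˡ i u {v} {w} e = trans (θ-++ i u v) (trans (cong (θ i u +ₖ_) e) (sym (θ-++ i u w)))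

  θ-step : ∀ i {u v} → Step u v → θ i u ≡ θ i v
  θ-step i (merge u v j a b) = θ-congˡ i u (begin
    θ i ((j , a) ∷ (j , b) ∷ v)                 ≡⟨ θ-∷ i (j , a) ((j , b) ∷ v) ⟩
    θ₁ i (j , a) +ₖ θ i ((j , b) ∷ v)           ≡⟨ cong (θ₁ i (j , a) +ₖ_) (θ-∷ i (j , b) v) ⟩
    θ₁ i (j , a) +ₖ (θ₁ i (j , b) +ₖ θ i v)     ≡⟨ +ₖ-assoc (θ₁ i (j , a)) (θ₁ i (j , b)) (θ i v) ⟨
    (θ₁ i (j , a) +ₖ θ₁ i (j , b)) +ₖ θ i v     ≡⟨ cong (_+ₖ θ i v) merged ⟩
    θ₁ i (j , a +ₖ b) +ₖ θ i v                  ≡⟨ θ-∷ i (j , a +ₖ b) v ⟨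
    θ i ((j , a +ₖ b) ∷ v)                      ∎)
    where
    open ≡-Reasoning
    merged : θ₁ i (j , a) +ₖ θ₁ i (j , b) ≡ θ₁ i (j , a +ₖ b)
    merged with ⌊ i ≟ j ⌋
    ... | true  = refl
    ... | false = +ₖ-identityˡ 0ₖ
  θ-step i (drop0 u v j a a≡0) = θ-congˡ i u (begin
    θ i ((j , a) ∷ v)      ≡⟨ θ-∷ i (j , a) v ⟩
    θ₁ i (j , a) +ₖ θ i v  ≡⟨ cong (λ a → θ₁ i (j , a) +ₖ θ i v) (toℕ≡0⇒≡0ₖ a≡0) ⟩
    θ₁ i (j , 0ₖ) +ₖ θ i v ≡⟨ cong (_+ₖ θ i v) vanishes ⟩
    0ₖ +ₖ θ i v            ≡⟨ +ₖ-identityˡ (θ i v) ⟩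
    θ i v                  ∎)
    where
    open ≡-Reasoning
    vanishes : θ₁ i (j , 0ₖ) ≡ 0ₖ
    vanishes with ⌊ i ≟ j ⌋
    ... | true  = refl
    ... | false = refl

  θ-resp-≈ : ∀ i {u v} → u ≈ v → θ i u ≡ θ i v
  θ-resp-≈ i = gfold isEquivalence (θ i) (θ-step i)

  inv-∷ : ∀ j a g → inv ((j , a) ∷ g) ≡ inv g ++ (j , -ₖ a) ∷ []
  inv-∷ j a g = unfold-reverse (j , -ₖ a) (map _ g)

  θ-inv : ∀ i g → θ i (inv g) ≡ -ₖ θ i g
  θ-inv i []            = sym ε⁻¹≈ε
  θ-inv i ((j , a) ∷ g) = begin
    θ i (inv ((j , a) ∷ g))            ≡⟨ cong (θ i) (inv-∷ j a g) ⟩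
    θ i (inv g ++ (j , -ₖ a) ∷ [])     ≡⟨ θ-++ i (inv g) _ ⟩
    θ i (inv g) +ₖ θ i ((j , -ₖ a) ∷ []) ≡⟨ cong₂ _+ₖ_ (θ-inv i g) (trans (θ-singleton i _) θ₁-neg) ⟩
    (-ₖ θ i g) +ₖ (-ₖ θ₁ i (j , a))    ≡⟨ ⁻¹-∙-comm (θ i g) (θ₁ i (j , a)) ⟩
    -ₖ (θ i g +ₖ θ₁ i (j , a))         ≡⟨ cong -ₖ_ (+ₖ-comm (θ i g) (θ₁ i (j , a))) ⟩
    -ₖ (θ₁ i (j , a) +ₖ θ i g)         ≡⟨ cong -ₖ_ (θ-∷ i (j , a) g) ⟨
    -ₖ θ i ((j , a) ∷ g)               ∎
    where
    open ≡-Reasoning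
    θ₁-neg : θ₁ i (j , -ₖ a) ≡ -ₖ θ₁ i (j , a)
    θ₁-neg with ⌊ i ≟ j ⌋
    ... | true  = refl
    ... | false = sym ε⁻¹≈ε

  -- The quotient G_{d,k}/M_{d,k}

  M⇒θ≡0ₖ : ∀ g → M g → ∀ i → θ i g ≡ 0ₖ
  M⇒θ≡0ₖ g Mg i = toℕ≡0⇒≡0ₖ (Mg i)

  θ≡0ₖ⇒M : ∀ g → (∀ i → θ i g ≡ 0ₖ) → M g
  θ≡0ₖ⇒M g θ≡0 i = trans (cong toℕ (θ≡0 i)) toℕ-0ₖ

  M-e : M e
  M-e = θ≡0ₖ⇒M [] (λ _ → refl)

  M-normalSubgroup : (∀ g h → g ≈ h → M g → M h)
                   × M e
                   × (∀ g h → M g → M h → M (g · h))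
                   × (∀ g → M g → M (inv g))
                   × (∀ g m → M m → M ((g · m) · inv g))
  M-normalSubgroup = resp-≈ , M-e , closed-· , closed-inv , closed-conj
    where
    resp-≈ : ∀ g h → g ≈ h → M g → M h
    resp-≈ g h g≈h Mg = θ≡0ₖ⇒M h λ i → trans (sym (θ-resp-≈ i g≈h)) (M⇒θ≡0ₖ g Mg i)
    closed-· : ∀ g h → M g → M h → M (g · h)
    closed-· g h Mg Mh = θ≡0ₖ⇒M (g ++ h) λ i → begin
      θ i (g ++ h)       ≡⟨ θ-++ i g h ⟩
      θ i g +ₖ θ i h     ≡⟨ cong₂ _+ₖ_ (M⇒θ≡0ₖ g Mg i) (M⇒θ≡0ₖ h Mh i) ⟩
      0ₖ +ₖ 0ₖ           ≡⟨ +ₖ-identityˡ 0ₖ ⟩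
      0ₖ                 ∎
      where open ≡-Reasoning
    closed-inv : ∀ g → M g → M (inv g)
    closed-inv g Mg = θ≡0ₖ⇒M (inv g) λ i → trans (θ-inv i g) (trans (cong -ₖ_ (M⇒θ≡0ₖ g Mg i)) ε⁻¹≈ε)
    closed-conj : ∀ g m → M m → M ((g · m) · inv g)
    closed-conj g m Mm = θ≡0ₖ⇒M ((g ++ m) ++ inv g) λ i → begin
      θ i ((g ++ m) ++ inv g)            ≡⟨ θ-++ i (g ++ m) (inv g) ⟩
      θ i (g ++ m) +ₖ θ i (inv g)        ≡⟨ cong₂ _+ₖ_ (θ-++ i g m) (θ-inv i g) ⟩
      (θ i g +ₖ θ i m) +ₖ (-ₖ θ i g)      ≡⟨ cong (λ x → (θ i g +ₖ x) +ₖ (-ₖ θ i g)) (M⇒θ≡0ₖ m Mm i) ⟩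
      (θ i g +ₖ 0ₖ) +ₖ (-ₖ θ i g)         ≡⟨ cong (_+ₖ (-ₖ θ i g)) (identityʳ (θ i g)) ⟩
      θ i g +ₖ (-ₖ θ i g)                ≡⟨ inverseʳ (θ i g) ⟩
      0ₖ                                 ∎
      where open ≡-Reasoning

  φ : Word → Zk^
  φ g i = θ i g

  φ≋⇔M : ∀ g h → (φ g ≋ φ h) ⇔ M (g · inv h)
  φ≋⇔M g h = mk⇔
    (λ φg≋φh → θ≡0ₖ⇒M (g · inv h) λ i → trans (θ-g·h⁻¹ i) (x≈y⇒x∙y⁻¹≈ε (φg≋φh i)))
    (λ M-g·h⁻¹ i → x∙y⁻¹≈ε⇒x≈y (θ i g) (θ i h)
                     (trans (sym (θ-g·h⁻¹ i)) (M⇒θ≡0ₖ (g · inv h) M-g·h⁻¹ i)))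
    where
    θ-g·h⁻¹ : ∀ i → θ i (g · inv h) ≡ θ i g +ₖ (-ₖ θ i h)
    θ-g·h⁻¹ i = trans (θ-++ i g (inv h)) (cong (θ i g +ₖ_) (θ-inv i h))

  LettersIn : Subset (suc d) → Word → Set
  LettersIn A = All (λ l → proj₁ l ∈ A)

  powers : (Fin (suc d) → Fin k) → List (Fin (suc d)) → Word
  powers t = map (λ i → i , t i)

  θ-powers-∉ : ∀ t {i} xs → ¬ (i List.∈ xs) → θ i (powers t xs) ≡ 0ₖ
  θ-powers-∉ t     []       i∉[]    = refl
  θ-powers-∉ t {i} (j ∷ xs) i∉j∷xs = begin
    θ i (powers t (j ∷ xs))             ≡⟨ θ-∷ i (j , t j) (powers t xs) ⟩
    θ₁ i (j , t j) +ₖ θ i (powers t xs) ≡⟨ cong₂ _+ₖ_ (θ₁-≢ (t j) (i∉j∷xs ∘ here))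
                                                       (θ-powers-∉ t xs (i∉j∷xs ∘ there)) ⟩
    0ₖ +ₖ 0ₖ                            ≡⟨ +ₖ-identityˡ 0ₖ ⟩
    0ₖ                                  ∎
    where open ≡-Reasoning

  θ-powers-∈ : ∀ t {i} {xs} → Unique xs → i List.∈ xs → θ i (powers t xs) ≡ t i
  θ-powers-∈ t {i} {.i ∷ xs} (i∉xs ∷ _) (here refl) = begin
    θ i (powers t (i ∷ xs))             ≡⟨ θ-∷ i (i , t i) (powers t xs) ⟩
    θ₁ i (i , t i) +ₖ θ i (powers t xs) ≡⟨ cong₂ _+ₖ_ (θ₁-≡ i (t i)) (θ-powers-∉ t xs (All¬⇒¬Any i∉xs)) ⟩
    t i +ₖ 0ₖ                           ≡⟨ identityʳ (t i) ⟩
    t i                                 ∎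
    where open ≡-Reasoning
  θ-powers-∈ t {i} {j ∷ xs} (j∉xs ∷ unique) (there i∈xs) = begin
    θ i (powers t (j ∷ xs))             ≡⟨ θ-∷ i (j , t j) (powers t xs) ⟩
    θ₁ i (j , t j) +ₖ θ i (powers t xs) ≡⟨ cong₂ _+ₖ_ (θ₁-≢ (t j) (λ { refl → All.lookup j∉xs i∈xs refl }))
                                                       (θ-powers-∈ t unique i∈xs) ⟩
    0ₖ +ₖ t i                           ≡⟨ +ₖ-identityˡ (t i) ⟩
    t i                                 ∎
    where open ≡-Reasoning

  powersIn : Subset (suc d) → (Fin (suc d) → Fin k) → Word
  powersIn A t = powers t (filter (_∈? A) (allFin (suc d)))

  powersIn-lettersIn : ∀ A t → LettersIn A (powersIn A t)
  powersIn-lettersIn A t = map⁺ (all-filter (_∈? A) (allFin (suc d)))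

  θ-powersIn-∈ : ∀ {A} t {i} → i ∈ A → θ i (powersIn A t) ≡ t i
  θ-powersIn-∈ {A} t {i} i∈A =
    θ-powers-∈ t (filter⁺ (_∈? A) (allFin⁺ (suc d))) (∈-filter⁺ (_∈? A) (∈-allFin i) i∈A)

  θ-powersIn-∉ : ∀ {A} t {i} → i ∉ A → θ i (powersIn A t) ≡ 0ₖ
  θ-powersIn-∉ {A} t {i} i∉A =
    θ-powers-∉ t (filter (_∈? A) (allFin (suc d))) (i∉A ∘ proj₂ ∘ ∈-filter⁻ (_∈? A) {xs = allFin (suc d)})

  φ-surjective : ∀ x → Σ Word λ g → φ g ≋ x
  φ-surjective x = powersIn ⊤ x , λ i → θ-powersIn-∈ x ∈⊤

  G/M≅ℤ/kℤ^[d+1] : Σ (Word → Zk^) λ φ →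
                          (∀ g h → (φ g ≋ φ h) ⇔ M (g · inv h))
                          × (∀ g h → φ (g · h) ≋ (φ g ⊕ φ h))
                          × (∀ x → Σ Word λ g → φ g ≋ x)
  G/M≅ℤ/kℤ^[d+1] = φ , φ≋⇔M , (λ g h i → θ-++ i g h) , φ-surjective

  M-index≡k^[d+1] : Σ (Word → Fin (k ^ suc d)) λ f →
            (∀ g h → (f g ≡ f h) ⇔ M (g · inv h))
            × (∀ n → Σ Word λ g → f g ≡ n)
  M-index≡k^[d+1] = funToFin ∘ φ , f≡⇔M , f-surjective
    where
    f≡⇔M : ∀ g h → (funToFin (φ g) ≡ funToFin (φ h)) ⇔ M (g · inv h)
    f≡⇔M g h = mk⇔
      (λ e → to (φ≋⇔M g h) λ i → trans (sym (finToFun-funToFin (φ g) i))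
                                   (trans (cong (λ n → finToFun n i) e) (finToFun-funToFin (φ h) i)))
      (λ M-g·h⁻¹ → funToFin-cong (from (φ≋⇔M g h) M-g·h⁻¹))
    f-surjective : ∀ n → Σ Word λ g → funToFin (φ g) ≡ n
    f-surjective n with φ-surjective (finToFun n)
    ... | g , φg≋n = g , trans (funToFin-cong φg≋n) (funToFin-finToFin {suc d} {k} n)

  -- Cancellation and cosets

  module ≈ = Setoid (setoid Step)

  step-congˡ : ∀ w {u v} → Step u v → Step (w ++ u) (w ++ v)
  step-congˡ w (merge u v i a b) = subst₂ Step (++-assoc w u _) (++-assoc w u _) (merge (w ++ u) v i a b)
  step-congˡ w (drop0 u v i a z) = subst₂ Step (++-assoc w u _) (++-assoc w u _) (drop0 (w ++ u) v i a z)

  step-congʳ : ∀ w {u v} → Step u v → Step (u ++ w) (v ++ w)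
  step-congʳ w (merge u v i a b) =
    subst₂ Step (sym (++-assoc u _ w)) (sym (++-assoc u _ w)) (merge u (v ++ w) i a b)
  step-congʳ w (drop0 u v i a z) =
    subst₂ Step (sym (++-assoc u _ w)) (sym (++-assoc u v w)) (drop0 u (v ++ w) i a z)

  ≈-congˡ : ∀ w {u v} → u ≈ v → (w ++ u) ≈ (w ++ v)
  ≈-congˡ w = gmap (w ++_) (step-congˡ w)

  ≈-congʳ : ∀ w {u v} → u ≈ v → (u ++ w) ≈ (v ++ w)
  ≈-congʳ w = gmap (_++ w) (step-congʳ w)

  cancel-pair : ∀ j a b w → a +ₖ b ≡ 0ₖ → ((j , a) ∷ (j , b) ∷ w) ≈ w
  cancel-pair j a b w a+b≡0 =
    ≈.trans (return (merge [] w j a b)) (return (drop0 [] w j (a +ₖ b) (trans (cong toℕ a+b≡0) toℕ-0ₖ)))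

  inv-cancelʳ : ∀ g w → (g ++ (inv g ++ w)) ≈ w
  inv-cancelʳ []            w = ≈.refl
  inv-cancelʳ ((j , a) ∷ g) w = begin
    (j , a) ∷ g ++ (inv ((j , a) ∷ g) ++ w)  ≡⟨ cong (λ u → (j , a) ∷ g ++ (u ++ w)) (inv-∷ j a g) ⟩
    (j , a) ∷ g ++ ((inv g ++ (j , -ₖ a) ∷ []) ++ w) ≡⟨ cong (λ u → (j , a) ∷ g ++ u) (++-assoc (inv g) _ w) ⟩
    (j , a) ∷ g ++ (inv g ++ (j , -ₖ a) ∷ w) ≈⟨ ≈-congˡ ((j , a) ∷ []) (inv-cancelʳ g ((j , -ₖ a) ∷ w)) ⟩
    (j , a) ∷ (j , -ₖ a) ∷ w                 ≈⟨ cancel-pair j a (-ₖ a) w (inverseʳ a) ⟩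
    w                                        ∎
    where open ≈-Reasoning (setoid Step)

  inv-cancelˡ : ∀ g w → (inv g ++ (g ++ w)) ≈ w
  inv-cancelˡ []            w = ≈.refl
  inv-cancelˡ ((j , a) ∷ g) w = begin
    inv ((j , a) ∷ g) ++ ((j , a) ∷ g ++ w)  ≡⟨ cong (_++ ((j , a) ∷ g ++ w)) (inv-∷ j a g) ⟩
    (inv g ++ (j , -ₖ a) ∷ []) ++ ((j , a) ∷ g ++ w) ≡⟨ ++-assoc (inv g) _ _ ⟩
    inv g ++ ((j , -ₖ a) ∷ (j , a) ∷ g ++ w) ≈⟨ ≈-congˡ (inv g) (cancel-pair j (-ₖ a) a (g ++ w) (-ₖ-inverseˡ a)) ⟩
    inv g ++ (g ++ w)                        ≈⟨ inv-cancelˡ g w ⟩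
    w                                        ∎
    where open ≈-Reasoning (setoid Step)

  lettersIn-inv : ∀ {A} g → LettersIn A g → LettersIn A (inv g)
  lettersIn-inv []            []            = []
  lettersIn-inv ((j , a) ∷ g) (j∈A ∷ g∈A) =
    subst (LettersIn _) (sym (inv-∷ j a g)) (++⁺ (lettersIn-inv g g∈A) (j∈A ∷ []))

  θ-lettersIn-∉ : ∀ {A i} w → LettersIn A w → i ∉ A → θ i w ≡ 0ₖ
  θ-lettersIn-∉         []            []          i∉A = refl
  θ-lettersIn-∉ {A} {i} ((j , a) ∷ w) (j∈A ∷ w∈A) i∉A = begin
    θ i ((j , a) ∷ w)     ≡⟨ θ-∷ i (j , a) w ⟩
    θ₁ i (j , a) +ₖ θ i w ≡⟨ cong₂ _+ₖ_ (θ₁-≢ a λ { refl → i∉A j∈A }) (θ-lettersIn-∉ w w∈A i∉A) ⟩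
    0ₖ +ₖ 0ₖ              ≡⟨ +ₖ-identityˡ 0ₖ ⟩
    0ₖ                    ∎
    where open ≡-Reasoning

  θ-coset-∉ : ∀ {A u x i} → InCoset A u x → i ∉ A → θ i x ≡ θ i u
  θ-coset-∉ {u = u} {x} {i} (y , (w , w∈A , w≈y) , x≈y·u) i∉A = begin
    θ i x         ≡⟨ θ-resp-≈ i x≈y·u ⟩
    θ i (y ++ u)  ≡⟨ θ-++ i y u ⟩
    θ i y +ₖ θ i u ≡⟨ cong (_+ₖ θ i u) (trans (sym (θ-resp-≈ i w≈y)) (θ-lettersIn-∉ w w∈A i∉A)) ⟩
    0ₖ +ₖ θ i u   ≡⟨ +ₖ-identityˡ (θ i u) ⟩
    θ i u         ∎
    where open ≡-Reasoning

  sameCoset-sym : ∀ {A u B v} → SameCoset A u B v → SameCoset B v A u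
  sameCoset-sym same x = mk⇔ (from (same x)) (to (same x))

  sameCoset-trans : ∀ {A u B v C w} → SameCoset A u B v → SameCoset B v C w → SameCoset A u C w
  sameCoset-trans same same' x = mk⇔ (to (same' x) ∘ to (same x)) (from (same x) ∘ from (same' x))

  sameCoset-resp-≈ : ∀ {A v v'} → v ≈ v' → SameCoset A v A v'
  sameCoset-resp-≈ v≈v' x = mk⇔
    (λ (y , y∈K , x≈y·v) → y , y∈K , ≈.trans x≈y·v (≈-congˡ y v≈v'))
    (λ (y , y∈K , x≈y·v') → y , y∈K , ≈.trans x≈y·v' (≈-congˡ y (≈.sym v≈v')))

  sameCoset-absorb : ∀ {A} x → LettersIn A x → ∀ u → SameCoset A u A (x ++ u)
  sameCoset-absorb x x∈A u z = mk⇔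
    (λ (y , (w , w∈A , w≈y) , z≈y·u) →
       y ++ inv x , (w ++ inv x , ++⁺ w∈A (lettersIn-inv x x∈A) , ≈-congʳ (inv x) w≈y) ,
       ≈.trans z≈y·u (≈.trans (≈-congˡ y (≈.sym (inv-cancelˡ x u)))
                              (≈.reflexive (sym (++-assoc y (inv x) (x ++ u))))))
    (λ (y , (w , w∈A , w≈y) , z≈y·xu) →
       y ++ x , (w ++ x , ++⁺ w∈A x∈A , ≈-congʳ x w≈y) ,
       ≈.trans z≈y·xu (≈.reflexive (sym (++-assoc y x u))))

  1ₖ : Fin k
  1ₖ = 1 mod k

  1ₖ≢0ₖ : 2 ≤ k → 1ₖ ≢ 0ₖ
  1ₖ≢0ₖ 2≤k 1ₖ≡0ₖ = contradiction 1≡0 λ ()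
    where
    open ≡-Reasoning
    1≡0 : 1 ≡ 0
    1≡0 = begin
      1       ≡⟨ m<n⇒m%n≡m 2≤k ⟨
      1 % k   ≡⟨ toℕ-mod 1 ⟨
      toℕ 1ₖ  ≡⟨ cong toℕ 1ₖ≡0ₖ ⟩
      toℕ 0ₖ  ≡⟨ toℕ-0ₖ ⟩
      0       ∎

  sameCoset-∉ : 2 ≤ k → ∀ {A u B v i} → SameCoset A u B v → i ∉ A → i ∉ B × θ i u ≡ θ i v
  sameCoset-∉ 2≤k {A} {u} {B} {v} {i} same i∉A = i∉B , sym θv≡θu
    where
    θ-Bv : ∀ {x} → InCoset B v x → θ i x ≡ θ i u
    θ-Bv x∈Bv = θ-coset-∉ (from (same _) x∈Bv) i∉A
    θv≡θu : θ i v ≡ θ i u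
    θv≡θu = θ-Bv ([] , ([] , [] , ≈.refl) , ≈.refl)
    i∉B : i ∉ B
    i∉B i∈B = 1ₖ≢0ₖ 2≤k (∙-cancelʳ (θ i v) 1ₖ 0ₖ (begin
      1ₖ +ₖ θ i v            ≡⟨ cong (_+ₖ θ i v) (θ₁-≡ i 1ₖ) ⟨
      θ₁ i (i , 1ₖ) +ₖ θ i v ≡⟨ θ-∷ i (i , 1ₖ) v ⟨
      θ i ((i , 1ₖ) ∷ v)     ≡⟨ θ-Bv ((i , 1ₖ) ∷ [] , ((i , 1ₖ) ∷ [] , i∈B ∷ [] , ≈.refl) , ≈.refl) ⟩
      θ i u                  ≡⟨ θv≡θu ⟨
      θ i v                  ≡⟨ +ₖ-identityˡ (θ i v) ⟨
      0ₖ +ₖ θ i v            ∎))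
      where open ≡-Reasoning

  translate : ∀ {A g g'} x → LettersIn A x → (∀ i → θ i (x ++ g) ≡ θ i g') →
              ∀ h → M h → Σ Word λ h' → M h' × SameCoset A (g · h) A (g' · h')
  translate {A} {g} {g'} x x∈A θ-xg≡θ-g' h Mh =
    h' , Mh' ,
    sameCoset-trans (sameCoset-absorb x x∈A (g ++ h)) (sameCoset-resp-≈ (≈.sym (inv-cancelʳ g' (x ++ (g ++ h)))))
    where
    h' : Word
    h' = inv g' ++ (x ++ (g ++ h))
    Mh' : M h'
    Mh' = θ≡0ₖ⇒M h' λ i → begin
      θ i h'                                  ≡⟨ θ-++ i (inv g') (x ++ (g ++ h)) ⟩
      θ i (inv g') +ₖ θ i (x ++ (g ++ h))     ≡⟨ cong₂ _+ₖ_ (θ-inv i g') (cong (θ i) (sym (++-assoc x g h))) ⟩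
      (-ₖ θ i g') +ₖ θ i ((x ++ g) ++ h)      ≡⟨ cong ((-ₖ θ i g') +ₖ_) (θ-++ i (x ++ g) h) ⟩
      (-ₖ θ i g') +ₖ (θ i (x ++ g) +ₖ θ i h)  ≡⟨ cong₂ (λ a b → (-ₖ θ i g') +ₖ (a +ₖ b))
                                                        (θ-xg≡θ-g' i) (M⇒θ≡0ₖ h Mh i) ⟩
      (-ₖ θ i g') +ₖ (θ i g' +ₖ 0ₖ)           ≡⟨ cong ((-ₖ θ i g') +ₖ_) (identityʳ (θ i g')) ⟩
      (-ₖ θ i g') +ₖ θ i g'                   ≡⟨ -ₖ-inverseˡ (θ i g') ⟩
      0ₖ                                      ∎
      where open ≡-Reasoning

  representative : ∀ J g g' → (∀ i → i ∈ J → θ i g ≡ θ i g') →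
                   Σ Word λ x → LettersIn (∁ J) x × (∀ i → θ i (x ++ g) ≡ θ i g')
  representative J g g' θ-agree = x , powersIn-lettersIn (∁ J) t , θ-xg≡θ-g'
    where
    t : Fin (suc d) → Fin k
    t i = θ i g' +ₖ (-ₖ θ i g)
    x : Word
    x = powersIn (∁ J) t
    θ-xg≡θ-g' : ∀ i → θ i (x ++ g) ≡ θ i g'
    θ-xg≡θ-g' i with i ∈? ∁ J
    ... | yes i∈∁J = begin
      θ i (x ++ g)     ≡⟨ θ-++ i x g ⟩
      θ i x +ₖ θ i g   ≡⟨ cong (_+ₖ θ i g) (θ-powersIn-∈ t i∈∁J) ⟩
      t i +ₖ θ i g     ≡⟨ //-rightDividesˡ (θ i g) (θ i g') ⟩
      θ i g'           ∎
      where open ≡-Reasoning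
    ... | no i∉∁J = begin
      θ i (x ++ g)     ≡⟨ θ-++ i x g ⟩
      θ i x +ₖ θ i g   ≡⟨ cong (_+ₖ θ i g) (θ-powersIn-∉ t i∉∁J) ⟩
      0ₖ +ₖ θ i g      ≡⟨ +ₖ-identityˡ (θ i g) ⟩
      θ i g            ≡⟨ θ-agree i (x∉∁p⇒x∈p i∉∁J) ⟩
      θ i g'           ∎
      where open ≡-Reasoning

  -- The multicomplex

  cell : Multicell → Cell
  cell (J , g) = (λ i → indicator (lookup J i) (θ i g)) ,
                 λ i → indicator-functional (lookup J i) (θ i g)

  Agree : Multicell → Multicell → Set
  Agree (J , g) (J' , g') = J ≡ J' × (∀ i → i ∈ J → θ i g ≡ θ i g')

  agree⇒equiv : ∀ c c' → Agree c c' → Equiv M c c'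
  agree⇒equiv (J , g) (.J , g') (refl , θ-agree) = forth , back
    where
    forth : ∀ h → M h → Σ Word λ h' → M h' × SameCoset (∁ J) (g · h) (∁ J) (g' · h')
    forth with representative J g g' θ-agree
    ... | x , x∈∁J , θ-xg≡θ-g' = translate x x∈∁J θ-xg≡θ-g'
    back : ∀ h' → M h' → Σ Word λ h → M h × SameCoset (∁ J) (g · h) (∁ J) (g' · h')
    back h' Mh' with representative J g' g (λ i i∈J → sym (θ-agree i i∈J))
    ... | x , x∈∁J , θ-xg'≡θ-g with translate x x∈∁J θ-xg'≡θ-g h' Mh'
    ...   | h , Mh , same = h , Mh , sameCoset-sym same

  equiv⇒agree : 2 ≤ k → ∀ c c' → Equiv M c c' → Agree c c'
  equiv⇒agree 2≤k (J , g) (J' , g') (forth , _) with forth [] M-e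
  ... | h' , Mh' , same = ⊆-antisym J⊆J' J'⊆J , θ-agree
    where
    ∈⇒∉∁ : ∀ {p : Subset (suc d)} {i} → i ∈ p → i ∉ ∁ p
    ∈⇒∉∁ i∈p i∈∁p = x∈∁p⇒x∉p i∈∁p i∈p
    J⊆J' : ∀ {i} → i ∈ J → i ∈ J'
    J⊆J' i∈J = x∉∁p⇒x∈p (proj₁ (sameCoset-∉ 2≤k same (∈⇒∉∁ i∈J)))
    J'⊆J : ∀ {i} → i ∈ J' → i ∈ J
    J'⊆J i∈J' = x∉∁p⇒x∈p (proj₁ (sameCoset-∉ 2≤k (sameCoset-sym same) (∈⇒∉∁ i∈J')))
    θ-agree : ∀ i → i ∈ J → θ i g ≡ θ i g'
    θ-agree i i∈J = begin
      θ i g               ≡⟨ cong (θ i) (++-identityʳ g) ⟨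
      θ i (g ++ [])       ≡⟨ proj₂ (sameCoset-∉ 2≤k same (∈⇒∉∁ i∈J)) ⟩
      θ i (g' ++ h')      ≡⟨ θ-++ i g' h' ⟩
      θ i g' +ₖ θ i h'    ≡⟨ cong (θ i g' +ₖ_) (M⇒θ≡0ₖ h' Mh' i) ⟩
      θ i g' +ₖ 0ₖ        ≡⟨ identityʳ (θ i g') ⟩
      θ i g'              ∎
      where open ≡-Reasoning

  cell≈C⇔agree : ∀ c c' → (cell c ≈C cell c') ⇔ Agree c c'
  cell≈C⇔agree (J , g) (J' , g') = mk⇔
    (λ same → ≗-lookup⇒≡ (λ i → proj₁ (to (row i) (same i))) ,
              λ i i∈J → proj₂ (to (row i) (same i)) ([]=⇒lookup i∈J))
    (λ { (refl , θ-agree) i → from (row i) (refl , λ i∈J → θ-agree i (lookup⇒[]= i J i∈J)) })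
    where
    row : ∀ i → _ ⇔ _
    row i = indicator-≗⇔ (lookup J i) (lookup J' i) (θ i g) (θ i g')

  equiv⇔cell≈C : 2 ≤ k → ∀ c c' → Equiv M c c' ⇔ (cell c ≈C cell c')
  equiv⇔cell≈C 2≤k c c' = mk⇔ (from (cell≈C⇔agree c c') ∘ equiv⇒agree 2≤k c c')
                                (agree⇒equiv c c' ∘ to (cell≈C⇔agree c c'))

  cell-surjective : ∀ τ → Σ Multicell λ c → cell c ≈C τ
  cell-surjective (s , functional) = (tabulate b , powersIn ⊤ x) , λ i a → begin
    lookup (tabulate b) i ∧ ⌊ θ i (powersIn ⊤ x) ≟ a ⌋ ≡⟨ cong₂ (λ β y → β ∧ ⌊ y ≟ a ⌋) (lookup∘tabulate b i)
                                                                                     (θ-powersIn-∈ x ∈⊤) ⟩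
    indicator (b i) (x i) a                           ≡⟨ proj₂ (proj₂ (row i)) a ⟩
    s i a                                             ∎
    where
    open ≡-Reasoning
    row : ∀ i → Σ Bool λ b → Σ (Fin k) λ x → indicator b x ≗ s i
    row i = indicator-complete (s i) (functional i) 0ₖ
    b : Fin (suc d) → Bool
    b i = proj₁ (row i)
    x : Fin (suc d) → Fin k
    x i = proj₁ (proj₂ (row i))

  rank≡size : ∀ c → rank c ≡ size (cell c)
  rank≡size (J , g) = trans (∣p∣≡count J)
    (cong sum (map-cong (λ i → sym (count-indicator (lookup J i) (θ i g))) (allFin (suc d))))

  cell-─⁅⁆ : ∀ J g i j b →
             proj₁ (cell (J ─ ⁅ i ⁆ , g)) j b ≡ proj₁ (cell (J , g)) j b ∧ not (⌊ i ≟ j ⌋ ∧ ⌊ θ i g ≟ b ⌋)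
  cell-─⁅⁆ J g i j b = begin
    lookup (J ─ ⁅ i ⁆) j ∧ ⌊ θ j g ≟ b ⌋                             ≡⟨ cong (_∧ ⌊ θ j g ≟ b ⌋) lookup-J─⁅i⁆ ⟩
    (lookup J j ∧ not ⌊ i ≟ j ⌋) ∧ ⌊ θ j g ≟ b ⌋                     ≡⟨ ∧-not-∧-distrib (lookup J j) ⌊ i ≟ j ⌋ ⌊ θ j g ≟ b ⌋ ⟩
    (lookup J j ∧ ⌊ θ j g ≟ b ⌋) ∧ not (⌊ i ≟ j ⌋ ∧ ⌊ θ j g ≟ b ⌋)  ≡⟨ cong (λ c → _ ∧ not c) same-vertex ⟩
    (lookup J j ∧ ⌊ θ j g ≟ b ⌋) ∧ not (⌊ i ≟ j ⌋ ∧ ⌊ θ i g ≟ b ⌋)  ∎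
    where
    open ≡-Reasoning
    lookup-J─⁅i⁆ : lookup (J ─ ⁅ i ⁆) j ≡ lookup J j ∧ not ⌊ i ≟ j ⌋
    lookup-J─⁅i⁆ = trans (lookup-─ J ⁅ i ⁆ j) (cong (λ c → lookup J j ∧ not c) (lookup-⁅⁆ i j))
    same-vertex : ⌊ i ≟ j ⌋ ∧ ⌊ θ j g ≟ b ⌋ ≡ ⌊ i ≟ j ⌋ ∧ ⌊ θ i g ≟ b ⌋
    same-vertex with i ≟ j
    ... | yes refl = refl
    ... | no _     = refl

  facet⇔boundary : 2 ≤ k → ∀ c τ → Facet τ (cell c) ⇔ Σ Multicell λ c' → InBoundary M c' c × (cell c' ≈C τ)
  facet⇔boundary 2≤k (J , g) τ = mk⇔ ⇒ ⇐
    where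
    ⇒ : Facet τ (cell (J , g)) → Σ Multicell λ c' → InBoundary M c' (J , g) × (cell c' ≈C τ)
    ⇒ (i , a , vertex , τ-row) with indicator-true (lookup J i) (θ i g) a vertex
    ... | i∈J , refl =
      (J ─ ⁅ i ⁆ , g) , (i , lookup⇒[]= i J i∈J , from (equiv⇔cell≈C 2≤k _ _) (λ _ _ → refl)) ,
      λ j b → trans (cell-─⁅⁆ J g i j b) (sym (τ-row j b))
    ⇐ : (Σ Multicell λ c' → InBoundary M c' (J , g) × (cell c' ≈C τ)) → Facet τ (cell (J , g))
    ⇐ (c' , (l , l∈J , equiv) , c'≈τ) =
      l , θ l g , cong₂ _∧_ ([]=⇒lookup l∈J) (≟-refl (θ l g)) ,
      λ j b → trans (sym (c'≈τ j b))
                    (trans (to (equiv⇔cell≈C 2≤k _ _) equiv j b) (cell-─⁅⁆ J g l j b))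

  X̃[M]≅completePartite : 2 ≤ k →
    Σ (Multicell → Cell) λ F →
      (∀ c c' → Equiv M c c' ⇔ (F c ≈C F c'))
      × (∀ τ → Σ Multicell λ c → F c ≈C τ)
      × (∀ c → rank c ≡ size (F c))
      × (∀ c τ → Facet τ (F c) ⇔ Σ Multicell λ c' → InBoundary M c' c × (F c' ≈C τ))
  X̃[M]≅completePartite 2≤k = cell , equiv⇔cell≈C 2≤k , cell-surjective , rank≡size , facet⇔boundary 2≤k

proposition10p1 : (d k : ℕ) {{nz : NonZero k}} → 2 ≤ k → let open G d k in
    ((∀ g h → g ≈ h → M g → M h)
     × M e
     × (∀ g h → M g → M h → M (g · h))
     × (∀ g → M g → M (inv g))
     × (∀ g m → M m → M ((g · m) · inv g)))
    × (Σ (Word → Fin (k ^ suc d)) λ f →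
         (∀ g h → (f g ≡ f h) ⇔ M (g · inv h))
         × (∀ n → Σ Word λ g → f g ≡ n))
    × (Σ (Word → Zk^) λ φ →
         (∀ g h → (φ g ≋ φ h) ⇔ M (g · inv h))
         × (∀ g h → φ (g · h) ≋ (φ g ⊕ φ h))
         × (∀ x → Σ Word λ g → φ g ≋ x))
    × (Σ (Multicell → Cell) λ F →
         (∀ c c' → Equiv M c c' ⇔ (F c ≈C F c'))
         × (∀ τ → Σ Multicell λ c → F c ≈C τ)
         × (∀ c → rank c ≡ size (F c))
         × (∀ c τ → Facet τ (F c) ⇔ Σ Multicell λ c' → InBoundary M c' c × (F c' ≈C τ)))
proposition10p1 d k 2≤k =
  M-normalSubgroup d k , M-index≡k^[d+1] d k , G/M≅ℤ/kℤ^[d+1] d k , X̃[M]≅completePartite d k 2≤k
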